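{- Let $(P,\leq)$ be a finite poset. Then there are at most $2^{|P|}$ partial orders on $P$ that are rotation-equivalent to $(P,\leq)$.
   Context: For a poset $(P,\leq)$: $x<y$ means $x\le y$, $x\ne y$; $x\perp y$ means incomparable; $X<Y$ means $x<y$ for all $x\in X,y\in Y$. A downset is $X$ with $y<x\in X\Rightarrow y\in X$; an up-set dually. For disjoint $A,C$ with $A$ a downset, $C$ an up-set, $A<C$, and $B=P\setminus(A\cup C)$, the rotation $\mathfrak R_{A,C}(P,\leq)$ is $(P,\preceq)$ with $x\preceq y$ iff: (i) $x,y$ both in $A$, both in $B$ or both in $C$, and $x\le y$; or (ii) $x\in B$, $y\in A$, $x\perp y$; or (iii) $x\in C$, $y\in A$; or (iv) $x\in C$, $y\in B$, $x\perp y$. Two posets on the same set are rotation-equivalent if one can be transformed into the other by a finite sequence of rotations, each applied to the current poset. -}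

module Defs where

open import Data.Nat using (ℕ)
open import Data.Fin using (Fin)
open import Data.Bool using (Bool; true; false)
open import Data.Product using (Σ; _×_; ∃₂)
open import Data.Sum using (_⊎_)
open import Data.List using (List; length)
open import Data.List.Relation.Unary.All using (All)
open import Data.List.Relation.Unary.AllPairs using (AllPairs)
open import Relation.Binary.PropositionalEquality using (_≡_; _≢_)
open import Relation.Nullary using (¬_)
open import Relation.Binary.Construct.Closure.ReflexiveTransitive using (Star)
open import Function.Bundles using (_⇔_)

-- The finite poset is (Fin n, R) where R : Fin n → Fin n → Bool is the
-- (decidable) order relation: x ≤ y  iff  R x y ≡ true.
BRel : ℕ → Set
BRel n = Fin n → Fin n → Bool

Subset : ℕ → Set
Subset n = Fin n → Bool

module _ {n : ℕ} where

  _∈_ : Fin n → Subset n → Set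
  x ∈ X = X x ≡ true

  Le : BRel n → Fin n → Fin n → Set
  Le R x y = R x y ≡ true

  Lt : BRel n → Fin n → Fin n → Set
  Lt R x y = Le R x y × x ≢ y

  Incomp : BRel n → Fin n → Fin n → Set
  Incomp R x y = ¬ Le R x y × ¬ Le R y x

  record IsPartialOrderB (R : BRel n) : Set where
    field
      refl′  : ∀ x → Le R x x
      antisym′ : ∀ x y → Le R x y → Le R y x → x ≡ y
      trans′ : ∀ x y z → Le R x y → Le R y z → Le R x z

  IsDownset : BRel n → Subset n → Set
  IsDownset R X = ∀ x y → Lt R y x → x ∈ X → y ∈ X

  IsUpset : BRel n → Subset n → Set
  IsUpset R X = ∀ x y → Lt R x y → x ∈ X → y ∈ X

  Disjoint : Subset n → Subset n → Set
  Disjoint A C = ∀ x → x ∈ A → x ∈ C → ⊥′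
    where open import Data.Empty using () renaming (⊥ to ⊥′)

  SetLt : BRel n → Subset n → Subset n → Set
  SetLt R X Y = ∀ x y → x ∈ X → y ∈ Y → Lt R x y

  -- admissible pair (A, C) for a rotation of R
  RotData : BRel n → Subset n → Subset n → Set
  RotData R A C = Disjoint A C × IsDownset R A × IsUpset R C × SetLt R A C

  _∈B[_,_] : Fin n → Subset n → Subset n → Set
  x ∈B[ A , C ] = ¬ (x ∈ A) × ¬ (x ∈ C)

  RotRel : BRel n → Subset n → Subset n → Fin n → Fin n → Set
  RotRel R A C x y =
      (((x ∈ A × y ∈ A) ⊎ (x ∈B[ A , C ] × y ∈B[ A , C ]) ⊎ (x ∈ C × y ∈ C)) × Le R x y)
    ⊎ (x ∈B[ A , C ] × y ∈ A × Incomp R x y)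
    ⊎ (x ∈ C × y ∈ A)
    ⊎ (x ∈ C × y ∈B[ A , C ] × Incomp R x y)

  RotationStep : BRel n → BRel n → Set
  RotationStep R S =
    ∃₂ λ (A C : Subset n) → RotData R A C × (∀ x y → Le S x y ⇔ RotRel R A C x y)

  RotationEquivalent : BRel n → BRel n → Set
  RotationEquivalent R S = Star RotationStep R S ⊎ Star RotationStep S R

  Distinct : BRel n → BRel n → Set
  Distinct R S = ¬ (∀ x y → R x y ≡ S x y)

module Submission where

-- Record the relative position of two distinct points x, y of
-- an order Q by a "comparison class" cmp Q x y ∈ ℤ₃:  0 if x ≤ y,  1 if x
-- and y are incomparable,  2 if y < x.  A rotation 𝔑_{A,C} acts on these
-- classes as a coboundary: with the potential K = 0 on A, 1 on B, 2 on C,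
--     cmp S x y + K x = cmp R x y + K y      (rotation-twist).
-- Such "twists" compose and invert, so any two orders rotation-equivalent to
-- R are twists of one another.  For partial orders a twist is rigid: if two
-- twisted partial orders have the same minimal elements, the potential is
-- constant (compare every point with a minimal element below it in each
-- order), hence the orders coincide (twisted-orders-agree).  So a partial
-- order rotation-equivalent to R is determined by its set of minimal
-- elements, a subset of P, and a list of distinct such orders is at most
-- 2^|P| long by the pigeonhole principle (list-pigeonhole).

open import Defs
open import Data.Nat using (ℕ; _≤_; _^_)
open import Data.List using (List; length)
open import Data.Product using (_×_)
open import Data.List.Relation.Unary.All using (All)
open import Data.List.Relation.Unary.AllPairs using (AllPairs)

open import Data.Nat using (s≤s)
open import Data.Nat.Properties using (_≤?_; ≰⇒>)
open import Data.Fin as Fin using (Fin; zero; suc; funToFin; finToFun)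
open import Data.Fin.Properties using (¬∀⟶∃¬; all?; pigeonhole; finToFun-funToFin)
open import Data.Fin.Induction using (po-wellFounded)
open import Data.Bool using (Bool; true; false; not; _∧_)
open import Data.Bool.Properties using (¬-not) renaming (_≟_ to _≟ᵇ_)
open import Data.Product using (Σ; Σ-syntax; _,_; proj₁; proj₂)
open import Data.Sum using (_⊎_; inj₁; inj₂)
open import Data.Unit using (⊤; tt)
open import Data.Empty using (⊥; ⊥-elim)
open import Data.List using (_∷_; lookup)
import Data.List.Relation.Unary.All as All
open import Data.List.Relation.Unary.AllPairs using (_∷_)
open import Data.List.Membership.Propositional.Properties using (∈-lookup)
open import Function using (_∘_; const)
open import Function.Bundles using (_⇔_; mk⇔; Equivalence)
open import Induction.WellFounded using (Acc; acc)
open import Relation.Nullary using (¬_; Dec; yes; no; does)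
open import Relation.Nullary.Decidable using (_×-dec_; _⊎-dec_; ¬?; dec-true; dec-false; decidable-stable)
open import Relation.Binary.Structures using (IsPartialOrder)
open import Relation.Binary.PropositionalEquality
  using (_≡_; _≢_; refl; sym; trans; cong; cong₂; isEquivalence; module ≡-Reasoning)
open import Relation.Binary.Construct.Closure.ReflexiveTransitive using (Star; ε; _◅_)

open ≡-Reasoning

data ℤ₃ : Set where
  z₀ z₁ z₂ : ℤ₃

rot : ℤ₃ → ℤ₃
rot z₀ = z₁
rot z₁ = z₂
rot z₂ = z₀

infixl 6 _⊕_

_⊕_ : ℤ₃ → ℤ₃ → ℤ₃
z₀ ⊕ b = b
z₁ ⊕ b = rot b
z₂ ⊕ b = rot (rot b)

⊖_ : ℤ₃ → ℤ₃
⊖ z₀ = z₀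
⊖ z₁ = z₂
⊖ z₂ = z₁

rot³ : ∀ a → rot (rot (rot a)) ≡ a
rot³ z₀ = refl
rot³ z₁ = refl
rot³ z₂ = refl

rot-⊕ : ∀ a b → rot a ⊕ b ≡ rot (a ⊕ b)
rot-⊕ z₀ b = refl
rot-⊕ z₁ b = refl
rot-⊕ z₂ b = sym (rot³ b)

⊕-assoc : ∀ a b c → (a ⊕ b) ⊕ c ≡ a ⊕ (b ⊕ c)
⊕-assoc z₀ b c = refl
⊕-assoc z₁ b c = rot-⊕ b c
⊕-assoc z₂ b c = trans (rot-⊕ (rot b) c) (cong rot (rot-⊕ b c))

⊕-identityʳ : ∀ a → a ⊕ z₀ ≡ a
⊕-identityʳ z₀ = refl
⊕-identityʳ z₁ = refl
⊕-identityʳ z₂ = refl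

⊕-comm : ∀ a b → a ⊕ b ≡ b ⊕ a
⊕-comm z₀ b  = sym (⊕-identityʳ b)
⊕-comm z₁ z₀ = refl
⊕-comm z₁ z₁ = refl
⊕-comm z₁ z₂ = refl
⊕-comm z₂ z₀ = refl
⊕-comm z₂ z₁ = refl
⊕-comm z₂ z₂ = refl

⊕-inverseˡ : ∀ a → ⊖ a ⊕ a ≡ z₀
⊕-inverseˡ z₀ = refl
⊕-inverseˡ z₁ = refl
⊕-inverseˡ z₂ = refl

⊕-cancelˡ : ∀ a {b c} → a ⊕ b ≡ a ⊕ c → b ≡ c
⊕-cancelˡ a {b} {c} eq = begin
  b                ≡⟨ cong (_⊕ b) (sym (⊕-inverseˡ a)) ⟩
  (⊖ a ⊕ a) ⊕ b    ≡⟨ ⊕-assoc (⊖ a) a b ⟩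
  ⊖ a ⊕ (a ⊕ b)    ≡⟨ cong (⊖ a ⊕_) eq ⟩
  ⊖ a ⊕ (a ⊕ c)    ≡⟨ sym (⊕-assoc (⊖ a) a c) ⟩
  (⊖ a ⊕ a) ⊕ c    ≡⟨ cong (_⊕ c) (⊕-inverseˡ a) ⟩
  c                ∎

⊕-cancelʳ : ∀ a {b c} → b ⊕ a ≡ c ⊕ a → b ≡ c
⊕-cancelʳ a {b} {c} eq = ⊕-cancelˡ a (trans (⊕-comm a b) (trans eq (⊕-comm c a)))

⊕-swapʳ : ∀ a b c → (a ⊕ b) ⊕ c ≡ (a ⊕ c) ⊕ b
⊕-swapʳ a b c = begin
  (a ⊕ b) ⊕ c  ≡⟨ ⊕-assoc a b c ⟩
  a ⊕ (b ⊕ c)  ≡⟨ cong (a ⊕_) (⊕-comm b c) ⟩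
  a ⊕ (c ⊕ b)  ≡⟨ sym (⊕-assoc a c b) ⟩
  (a ⊕ c) ⊕ b  ∎

⊕-⊖-cancel : ∀ a b → (a ⊕ b) ⊕ ⊖ b ≡ a
⊕-⊖-cancel a b = begin
  (a ⊕ b) ⊕ ⊖ b  ≡⟨ ⊕-assoc a b (⊖ b) ⟩
  a ⊕ (b ⊕ ⊖ b)  ≡⟨ cong (a ⊕_) (trans (⊕-comm b (⊖ b)) (⊕-inverseˡ b)) ⟩
  a ⊕ z₀         ≡⟨ ⊕-identityʳ a ⟩
  a              ∎

-- Two steps, each of size 0 or 1, return to the start only if both vanish;
-- this is the arithmetic heart of the rigidity argument.
small-sum-zero : ∀ {a b} → a ≢ z₂ → b ≢ z₂ → a ⊕ b ≡ z₀ → a ≡ z₀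
small-sum-zero {z₀} _ _ _ = refl
small-sum-zero {z₁} {z₀} _ _ ()
small-sum-zero {z₁} {z₁} _ _ ()
small-sum-zero {z₁} {z₂} _ b≢2 _ = ⊥-elim (b≢2 refl)
small-sum-zero {z₂} a≢2 _ _ = ⊥-elim (a≢2 refl)

no-short-cycle : ∀ {a b u v} → a ≢ z₂ → b ≢ z₂ → u ≡ a ⊕ v → v ≡ b ⊕ u → u ≡ v
no-short-cycle {a} {b} {u} {v} a≢2 b≢2 u≡ v≡ = begin
  u      ≡⟨ u≡ ⟩
  a ⊕ v  ≡⟨ cong (_⊕ v) (small-sum-zero a≢2 b≢2 a⊕b≡0) ⟩
  v      ∎
  where
  a⊕b≡0 : a ⊕ b ≡ z₀
  a⊕b≡0 = ⊕-cancelʳ u (sym (begin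
    u            ≡⟨ u≡ ⟩
    a ⊕ v        ≡⟨ cong (a ⊕_) v≡ ⟩
    a ⊕ (b ⊕ u)  ≡⟨ sym (⊕-assoc a b u) ⟩
    a ⊕ b ⊕ u    ∎))

-- Comparison classes and twists

cmpᵇ : Bool → Bool → ℤ₃
cmpᵇ true  _     = z₀
cmpᵇ false false = z₁
cmpᵇ false true  = z₂

-- For distinct points the class determines whether x ≤ y.
cmpᵇ-injective : ∀ r s r' s' → cmpᵇ r s ≡ cmpᵇ r' s' → r ≡ r'
cmpᵇ-injective true  _     true  _     _  = refl
cmpᵇ-injective false _     false _     _  = refl
cmpᵇ-injective true  _     false false ()
cmpᵇ-injective true  _     false true  ()
cmpᵇ-injective false false true  _     ()
cmpᵇ-injective false true  true  _     ()

cmpᵇ-not-above : ∀ r {s} → s ≡ false → cmpᵇ r s ≢ z₂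
cmpᵇ-not-above true  refl ()
cmpᵇ-not-above false refl ()

module _ {n : ℕ} where

  cmp : BRel n → Fin n → Fin n → ℤ₃
  cmp Q x y = cmpᵇ (Q x y) (Q y x)

  TwistedBy : (Fin n → ℤ₃) → BRel n → BRel n → Set
  TwistedBy K Q Q' = ∀ x y → x ≢ y → cmp Q' x y ⊕ K x ≡ cmp Q x y ⊕ K y

  record Twist (Q Q' : BRel n) : Set where
    constructor twist
    field
      potential : Fin n → ℤ₃
      twisted   : TwistedBy potential Q Q'

  twist-refl : ∀ {Q} → Twist Q Q
  twist-refl = twist (const z₀) λ _ _ _ → refl

  twist-trans : ∀ {Q₁ Q₂ Q₃} → Twist Q₁ Q₂ → Twist Q₂ Q₃ → Twist Q₁ Q₃
  twist-trans {Q₁} {Q₂} {Q₃} (twist K p) (twist L q) = twist (λ x → K x ⊕ L x) twisted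
    where
    twisted : TwistedBy (λ x → K x ⊕ L x) Q₁ Q₃
    twisted x y x≢y = begin
      cmp Q₃ x y ⊕ (K x ⊕ L x)  ≡⟨ cong (cmp Q₃ x y ⊕_) (⊕-comm (K x) (L x)) ⟩
      cmp Q₃ x y ⊕ (L x ⊕ K x)  ≡⟨ sym (⊕-assoc (cmp Q₃ x y) (L x) (K x)) ⟩
      cmp Q₃ x y ⊕ L x ⊕ K x    ≡⟨ cong (_⊕ K x) (q x y x≢y) ⟩
      cmp Q₂ x y ⊕ L y ⊕ K x    ≡⟨ ⊕-swapʳ (cmp Q₂ x y) (L y) (K x) ⟩
      cmp Q₂ x y ⊕ K x ⊕ L y    ≡⟨ cong (_⊕ L y) (p x y x≢y) ⟩
      cmp Q₁ x y ⊕ K y ⊕ L y    ≡⟨ ⊕-assoc (cmp Q₁ x y) (K y) (L y) ⟩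
      cmp Q₁ x y ⊕ (K y ⊕ L y)  ∎

  twist-sym : ∀ {Q₁ Q₂} → Twist Q₁ Q₂ → Twist Q₂ Q₁
  twist-sym {Q₁} {Q₂} (twist K p) = twist (⊖_ ∘ K) twisted
    where
    twisted : TwistedBy (⊖_ ∘ K) Q₂ Q₁
    twisted x y x≢y = begin
      cmp Q₁ x y ⊕ ⊖ K x                 ≡⟨ sym (⊕-⊖-cancel _ (K y)) ⟩
      cmp Q₁ x y ⊕ ⊖ K x ⊕ K y ⊕ ⊖ K y   ≡⟨ cong (_⊕ ⊖ K y) (⊕-swapʳ (cmp Q₁ x y) (⊖ K x) (K y)) ⟩
      cmp Q₁ x y ⊕ K y ⊕ ⊖ K x ⊕ ⊖ K y   ≡⟨ cong (λ t → t ⊕ ⊖ K x ⊕ ⊖ K y) (sym (p x y x≢y)) ⟩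
      cmp Q₂ x y ⊕ K x ⊕ ⊖ K x ⊕ ⊖ K y   ≡⟨ cong (_⊕ ⊖ K y) (⊕-⊖-cancel (cmp Q₂ x y) (K x)) ⟩
      cmp Q₂ x y ⊕ ⊖ K y                 ∎

-- Rotations are twists

-- Whether x ⪯ y in 𝔑_{A,C}(R) depends only on the bits a = [x ∈ A],
-- c = [x ∈ C], a' = [y ∈ A], c' = [y ∈ C], r = [x ≤ y], r' = [y ≤ x]:
-- RotRel R A C x y is by definition RotRelᵇ (A x) (C x) (A y) (C y) (R x y) (R y x).
RotRelᵇ : (a c a' c' r r' : Bool) → Set
RotRelᵇ a c a' c' r r' =
    (((a ≡ true × a' ≡ true) ⊎ (InB a c × InB a' c') ⊎ (c ≡ true × c' ≡ true)) × r ≡ true)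
  ⊎ (InB a c × a' ≡ true × ¬ r ≡ true × ¬ r' ≡ true)
  ⊎ (c ≡ true × a' ≡ true)
  ⊎ (c ≡ true × InB a' c' × ¬ r ≡ true × ¬ r' ≡ true)
  where
  InB : Bool → Bool → Set
  InB a c = ¬ a ≡ true × ¬ c ≡ true

rotRelᵇ? : ∀ a c a' c' r r' → Dec (RotRelᵇ a c a' c' r r')
rotRelᵇ? a c a' c' r r' =
      ((((a ≟ᵇ true) ×-dec (a' ≟ᵇ true)) ⊎-dec (inB? a c ×-dec inB? a' c') ⊎-dec ((c ≟ᵇ true) ×-dec (c' ≟ᵇ true)))
        ×-dec (r ≟ᵇ true))
  ⊎-dec (inB? a c ×-dec (a' ≟ᵇ true) ×-dec ¬? (r ≟ᵇ true) ×-dec ¬? (r' ≟ᵇ true))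
  ⊎-dec ((c ≟ᵇ true) ×-dec (a' ≟ᵇ true))
  ⊎-dec ((c ≟ᵇ true) ×-dec inB? a' c' ×-dec ¬? (r ≟ᵇ true) ×-dec ¬? (r' ≟ᵇ true))
  where
  inB? : ∀ a c → Dec (¬ a ≡ true × ¬ c ≡ true)
  inB? a c = ¬? (a ≟ᵇ true) ×-dec ¬? (c ≟ᵇ true)

data Block : Set where
  lower middle upper : Block

height : Block → ℤ₃
height lower  = z₀
height middle = z₁
height upper  = z₂

data Position (a c : Bool) : Block → Set where
  inLower  : a ≡ true  → c ≡ false → Position a c lower
  inMiddle : a ≡ false → c ≡ false → Position a c middle
  inUpper  : a ≡ false → c ≡ true  → Position a c upper

position : ∀ a c → (a ≡ true → c ≡ true → ⊥) → Σ Block (Position a c)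
position true  false _        = lower  , inLower  refl refl
position true  true  disjoint = ⊥-elim (disjoint refl refl)
position false false _        = middle , inMiddle refl refl
position false true  _        = upper  , inUpper  refl refl

rotated : Block → Block → Bool → Bool → Bool
rotated lower  lower  r _  = r
rotated middle middle r _  = r
rotated upper  upper  r _  = r
rotated middle lower  r r' = not r ∧ not r'
rotated upper  lower  _ _  = true
rotated upper  middle r r' = not r ∧ not r'
rotated lower  middle _ _  = false
rotated lower  upper  _ _  = false
rotated middle upper  _ _  = false

rotRelᵇ-table : ∀ {a c a' c' b b'} → Position a c b → Position a' c' b' →
                ∀ r r' → does (rotRelᵇ? a c a' c' r r') ≡ rotated b b' r r'
rotRelᵇ-table (inLower  refl refl) (inLower  refl refl) true  _     = refl
rotRelᵇ-table (inLower  refl refl) (inLower  refl refl) false _     = refl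
rotRelᵇ-table (inMiddle refl refl) (inMiddle refl refl) true  _     = refl
rotRelᵇ-table (inMiddle refl refl) (inMiddle refl refl) false _     = refl
rotRelᵇ-table (inUpper  refl refl) (inUpper  refl refl) true  _     = refl
rotRelᵇ-table (inUpper  refl refl) (inUpper  refl refl) false _     = refl
rotRelᵇ-table (inMiddle refl refl) (inLower  refl refl) true  _     = refl
rotRelᵇ-table (inMiddle refl refl) (inLower  refl refl) false true  = refl
rotRelᵇ-table (inMiddle refl refl) (inLower  refl refl) false false = refl
rotRelᵇ-table (inUpper  refl refl) (inMiddle refl refl) true  _     = refl
rotRelᵇ-table (inUpper  refl refl) (inMiddle refl refl) false true  = refl
rotRelᵇ-table (inUpper  refl refl) (inMiddle refl refl) false false = refl
rotRelᵇ-table (inUpper  refl refl) (inLower  refl refl) _     _     = refl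
rotRelᵇ-table (inLower  refl refl) (inMiddle refl refl) _     _     = refl
rotRelᵇ-table (inLower  refl refl) (inUpper  refl refl) _     _     = refl
rotRelᵇ-table (inMiddle refl refl) (inUpper  refl refl) _     _     = refl

-- What an admissible pair (A, C) forces on r = [x ≤ y], r' = [y ≤ x] for
-- distinct x, y in the given blocks (A is a downset, C an upset, A < C).
Allowed : Block → Block → Bool → Bool → Set
Allowed lower  middle _ r' = r' ≡ false
Allowed middle lower  r _  = r ≡ false
Allowed middle upper  _ r' = r' ≡ false
Allowed upper  middle r _  = r ≡ false
Allowed lower  upper  r _  = r ≡ true
Allowed upper  lower  r r' = r ≡ false × r' ≡ true
Allowed lower  lower  _ _  = ⊤
Allowed middle middle _ _  = ⊤
Allowed upper  upper  _ _  = ⊤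

rotation-shift : ∀ b b' r r' → Allowed b b' r r' →
                 cmpᵇ (rotated b b' r r') (rotated b' b r' r) ⊕ height b ≡ cmpᵇ r r' ⊕ height b'
rotation-shift lower  lower  _     _     _             = refl
rotation-shift middle middle _     _     _             = refl
rotation-shift upper  upper  _     _     _             = refl
rotation-shift lower  middle true  false refl          = refl
rotation-shift lower  middle false false refl          = refl
rotation-shift middle lower  false true  refl          = refl
rotation-shift middle lower  false false refl          = refl
rotation-shift middle upper  true  false refl          = refl
rotation-shift middle upper  false false refl          = refl
rotation-shift upper  middle false true  refl          = refl
rotation-shift upper  middle false false refl          = refl
rotation-shift lower  upper  true  _     refl          = refl
rotation-shift upper  lower  false true  (refl , refl) = refl

reflects-does : ∀ {P : Set} {b} → (b ≡ true ⇔ P) → (d : Dec P) → b ≡ does d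
reflects-does {b = true}  b⇔P d = sym (dec-true d (Equivalence.to b⇔P refl))
reflects-does {b = false} b⇔P d = sym (dec-false d ((λ ()) ∘ Equivalence.from b⇔P))

clash : ∀ {b} → b ≡ true → b ≡ false → ⊥
clash refl ()

module _ {n : ℕ} {R : BRel n} {A C : Subset n} (admissible : RotData R A C) where
  private
    disjoint = proj₁ admissible
    downset  = proj₁ (proj₂ admissible)
    upset    = proj₁ (proj₂ (proj₂ admissible))
    A<C      = proj₂ (proj₂ (proj₂ admissible))

  allowed : ∀ {x y b b'} → x ≢ y → Position (A x) (C x) b → Position (A y) (C y) b' →
            Allowed b b' (R x y) (R y x)
  allowed _ (inLower _ _) (inLower _ _) = tt
  allowed _ (inMiddle _ _) (inMiddle _ _) = tt
  allowed _ (inUpper _ _) (inUpper _ _) = tt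
  allowed x≢y (inLower ax _) (inMiddle ay _) =
    ¬-not λ ryx → clash (downset _ _ (ryx , x≢y ∘ sym) ax) ay
  allowed x≢y (inMiddle ax _) (inLower ay _) =
    ¬-not λ rxy → clash (downset _ _ (rxy , x≢y) ay) ax
  allowed x≢y (inMiddle _ cx) (inUpper _ cy) =
    ¬-not λ ryx → clash (upset _ _ (ryx , x≢y ∘ sym) cy) cx
  allowed x≢y (inUpper _ cx) (inMiddle _ cy) =
    ¬-not λ rxy → clash (upset _ _ (rxy , x≢y) cx) cy
  allowed _ (inLower ax _) (inUpper _ cy) = proj₁ (A<C _ _ ax cy)
  allowed x≢y (inUpper ax cx) (inLower ay _) =
    (¬-not λ rxy → clash (downset _ _ (rxy , x≢y) ay) ax) , proj₁ (A<C _ _ ay cx)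

  block : Fin n → Block
  block x = proj₁ (position (A x) (C x) (disjoint x))

  block-position : ∀ x → Position (A x) (C x) (block x)
  block-position x = proj₂ (position (A x) (C x) (disjoint x))

  rotated-order : ∀ {S} → (∀ x y → Le S x y ⇔ RotRel R A C x y) →
                  ∀ x y → S x y ≡ rotated (block x) (block y) (R x y) (R y x)
  rotated-order S⇔ x y =
    trans (reflects-does (S⇔ x y) (rotRelᵇ? (A x) (C x) (A y) (C y) (R x y) (R y x)))
          (rotRelᵇ-table (block-position x) (block-position y) (R x y) (R y x))

  rotation-twisted : ∀ {S} → (∀ x y → Le S x y ⇔ RotRel R A C x y) →
                     TwistedBy (height ∘ block) R S
  rotation-twisted {S} S⇔ x y x≢y = begin
    cmp S x y ⊕ height (block x)
      ≡⟨ cong (_⊕ height (block x)) (cong₂ cmpᵇ (rotated-order S⇔ x y) (rotated-order S⇔ y x)) ⟩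
    cmpᵇ (rotated (block x) (block y) (R x y) (R y x)) (rotated (block y) (block x) (R y x) (R x y))
      ⊕ height (block x)
      ≡⟨ rotation-shift (block x) (block y) (R x y) (R y x)
           (allowed x≢y (block-position x) (block-position y)) ⟩
    cmp R x y ⊕ height (block y)
      ∎

module _ {n : ℕ} where

  -- A single rotation is a twist; no order axioms of R are needed for this.
  rotation-twist : ∀ {R S : BRel n} → RotationStep R S → Twist R S
  rotation-twist (_ , _ , admissible , S⇔) = twist (height ∘ block admissible) (rotation-twisted admissible S⇔)

  rotations-twist : ∀ {R S : BRel n} → Star RotationStep R S → Twist R S
  rotations-twist ε              = twist-refl
  rotations-twist (step ◅ steps) = twist-trans (rotation-twist step) (rotations-twist steps)

  equivalent-twist : ∀ {R S : BRel n} → RotationEquivalent R S → Twist R S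
  equivalent-twist (inj₁ forward)  = rotations-twist forward
  equivalent-twist (inj₂ backward) = twist-sym (rotations-twist backward)

module _ {n : ℕ} where

  IsMinimal : BRel n → Fin n → Set
  IsMinimal Q m = ∀ y → ¬ Lt Q y m

  lt? : ∀ Q x y → Dec (Lt {n} Q x y)
  lt? Q x y = (Q x y ≟ᵇ true) ×-dec ¬? (x Fin.≟ y)

  isMinimal? : ∀ Q m → Dec (IsMinimal Q m)
  isMinimal? Q m = all? λ y → ¬? (lt? Q y m)

  minimals : BRel n → Subset n
  minimals Q m = does (isMinimal? Q m)

  below-minimal : ∀ {Q m x} → IsMinimal Q m → x ≢ m → Q x m ≡ false
  below-minimal m-min x≢m = ¬-not λ x≤m → m-min _ (x≤m , x≢m)

  minimals-incomparable : ∀ {Q m m'} → IsMinimal Q m → IsMinimal Q m' → m ≢ m' → cmp Q m m' ≡ z₁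
  minimals-incomparable {Q = Q} m-min m'-min m≢m' =
    cong₂ cmpᵇ (below-minimal {Q} m'-min m≢m') (below-minimal {Q} m-min (m≢m' ∘ sym))

  isPartialOrder : ∀ {Q} → IsPartialOrderB Q → IsPartialOrder _≡_ (Le {n} Q)
  isPartialOrder po = record
    { isPreorder = record
      { isEquivalence = isEquivalence
      ; reflexive     = λ { refl → refl′ _ }
      ; trans         = trans′ _ _ _
      }
    ; antisym = antisym′ _ _
    }
    where open IsPartialOrderB po

  minimal-below : ∀ {Q} → IsPartialOrderB Q → ∀ x → Σ[ m ∈ Fin n ] IsMinimal Q m × Le Q m x
  minimal-below {Q} po x = descend x (po-wellFounded (isPartialOrder po) x)
    where
    open IsPartialOrderB po
    descend : ∀ x → Acc (Lt Q) x → Σ[ m ∈ Fin n ] IsMinimal Q m × Le Q m x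
    descend x (acc smaller) with isMinimal? Q x
    ... | yes x-min = x , x-min , refl′ x
    ... | no x-not-min =
      let (y , ¬¬y<x)       = ¬∀⟶∃¬ n _ (λ y → ¬? (lt? Q y x)) x-not-min
          y<x               = decidable-stable (lt? Q y x) ¬¬y<x
          (m , m-min , m≤y) = descend y (smaller y<x)
      in m , m-min , trans′ m y x m≤y (proj₁ y<x)

-- Rigidity: twisted partial orders with the same minimal elements coincide

module Rigidity {n : ℕ} {Q Q' : BRel n} (po : IsPartialOrderB Q) (po' : IsPartialOrderB Q')
                (τ : Twist Q Q') (same-minimals : ∀ m → IsMinimal Q m ⇔ IsMinimal Q' m) where
  open Twist τ renaming (potential to K)

  -- Between common minimal elements the class is 1 in both orders,
  -- so the potential is the same at all minimal elements.
  potential-on-minimals : ∀ {m m'} → IsMinimal Q m → IsMinimal Q m' → K m ≡ K m'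
  potential-on-minimals {m} {m'} m-min m'-min with m Fin.≟ m'
  ... | yes refl = refl
  ... | no m≢m' = ⊕-cancelˡ z₁ (begin
    z₁ ⊕ K m            ≡⟨ cong (_⊕ K m) (sym (minimals-incomparable {Q = Q'} (to m-min) (to m'-min) m≢m')) ⟩
    cmp Q' m m' ⊕ K m   ≡⟨ twisted m m' m≢m' ⟩
    cmp Q m m' ⊕ K m'   ≡⟨ cong (_⊕ K m') (minimals-incomparable {Q = Q} m-min m'-min m≢m') ⟩
    z₁ ⊕ K m'           ∎)
    where
    to : ∀ {x} → IsMinimal Q x → IsMinimal Q' x
    to = Equivalence.to (same-minimals _)

  -- Compare a non-minimal x with a Q-minimal m₁ ≤ x and a Q'-minimal m₂ ≤' x.
  -- With κ the common potential of the minimal elements, the twist gives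
  -- K x = κ + (step 0 or 1) and κ = K x + (step 0 or 1), so K x = κ.
  potential-constant : ∀ {m} → IsMinimal Q m → ∀ x → K x ≡ K m
  potential-constant {m} m-min x with isMinimal? Q x | minimal-below po x | minimal-below po' x
  ... | yes x-min    | _                    | _ = potential-on-minimals x-min m-min
  ... | no x-not-min | m₁ , m₁-min , m₁≤x | m₂ , m₂-min' , m₂≤x =
    no-short-cycle (cmpᵇ-not-above (Q' m₁ x) (below-minimal {Q = Q'} m₁-min' x≢m₁))
                   (cmpᵇ-not-above (Q m₂ x) (below-minimal {Q = Q} m₂-min x≢m₂))
                   step₁ step₂
    where
    m₁-min' = Equivalence.to (same-minimals m₁) m₁-min
    m₂-min  = Equivalence.from (same-minimals m₂) m₂-min'

    x≢m₁ : x ≢ m₁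
    x≢m₁ refl = x-not-min m₁-min
    x≢m₂ : x ≢ m₂
    x≢m₂ refl = x-not-min m₂-min

    -- m₁ ≤ x has class 0 in Q, and m₂ ≤' x has class 0 in Q'
    step₁ : K x ≡ cmp Q' m₁ x ⊕ K m
    step₁ = begin
      K x                 ≡⟨ cong (λ r → cmpᵇ r (Q x m₁) ⊕ K x) (sym m₁≤x) ⟩
      cmp Q m₁ x ⊕ K x    ≡⟨ sym (twisted m₁ x (x≢m₁ ∘ sym)) ⟩
      cmp Q' m₁ x ⊕ K m₁  ≡⟨ cong (cmp Q' m₁ x ⊕_) (potential-on-minimals m₁-min m-min) ⟩
      cmp Q' m₁ x ⊕ K m   ∎
    step₂ : K m ≡ cmp Q m₂ x ⊕ K x
    step₂ = begin
      K m                 ≡⟨ potential-on-minimals m-min m₂-min ⟩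
      K m₂                ≡⟨ cong (λ r → cmpᵇ r (Q' x m₂) ⊕ K m₂) (sym m₂≤x) ⟩
      cmp Q' m₂ x ⊕ K m₂  ≡⟨ twisted m₂ x (x≢m₂ ∘ sym) ⟩
      cmp Q m₂ x ⊕ K x    ∎

  -- With a constant potential the twist is trivial.
  twisted-orders-agree : ∀ x y → Q x y ≡ Q' x y
  twisted-orders-agree x y with x Fin.≟ y
  ... | yes refl = trans (refl′ po x) (sym (refl′ po' x))
    where open IsPartialOrderB
  ... | no x≢y = cmpᵇ-injective (Q x y) (Q y x) (Q' x y) (Q' y x) (sym (⊕-cancelʳ (K x) (begin
    cmp Q' x y ⊕ K x  ≡⟨ twisted x y x≢y ⟩
    cmp Q x y ⊕ K y   ≡⟨ cong (cmp Q x y ⊕_) (trans (potential-constant m-min y) (sym (potential-constant m-min x))) ⟩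
    cmp Q x y ⊕ K x   ∎)))
    where
    m-min = proj₁ (proj₂ (minimal-below po x))

bit : Bool → Fin 2
bit false = zero
bit true  = suc zero

bit-injective : ∀ {a b} → bit a ≡ bit b → a ≡ b
bit-injective {false} {false} _ = refl
bit-injective {true}  {true}  _ = refl
bit-injective {false} {true}  ()
bit-injective {true}  {false} ()

code : ∀ {n} → Subset n → Fin (2 ^ n)
code S = funToFin (bit ∘ S)

code-injective : ∀ {n} {S T : Subset n} → code S ≡ code T → ∀ i → S i ≡ T i
code-injective {S = S} {T} same i = bit-injective (begin
  bit (S i)            ≡⟨ sym (finToFun-funToFin (bit ∘ S) i) ⟩
  finToFun (code S) i  ≡⟨ cong (λ c → finToFun c i) same ⟩
  finToFun (code T) i  ≡⟨ finToFun-funToFin (bit ∘ T) i ⟩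
  bit (T i)            ∎)

module _ {A : Set} where

  allPairs-lookup : ∀ {R : A → A → Set} {xs : List A} → AllPairs R xs →
                    ∀ {i j} → i Fin.< j → R (lookup xs i) (lookup xs j)
  allPairs-lookup (Rx ∷ _)  {zero}  {suc j} _         = All.lookup Rx (∈-lookup j)
  allPairs-lookup (_ ∷ Rxs) {suc i} {suc j} (s≤s i<j) = allPairs-lookup Rxs i<j

  list-pigeonhole : ∀ {m} {P : A → Set} {R : A → A → Set} (f : A → Fin m) →
                    (∀ {a b} → P a → P b → f a ≡ f b → ¬ R a b) →
                    ∀ {xs} → All P xs → AllPairs R xs → length xs ≤ m
  list-pigeonhole {m} f collide {xs} Ps Rs with length xs ≤? m
  ... | yes fits    = fits
  ... | no overflow with pigeonhole (≰⇒> overflow) (f ∘ lookup xs)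
  ... | i , j , i<j , same =
    ⊥-elim (collide (All.lookup Ps (∈-lookup i)) (All.lookup Ps (∈-lookup j)) same (allPairs-lookup Rs i<j))

does-agree : ∀ {P P' : Set} (p? : Dec P) (p'? : Dec P') → does p? ≡ does p'? → P ⇔ P'
does-agree (yes p) (yes p') _  = mk⇔ (const p') (const p)
does-agree (no ¬p) (no ¬p') _  = mk⇔ (⊥-elim ∘ ¬p) (⊥-elim ∘ ¬p')
does-agree (yes _) (no _)   ()
does-agree (no _)  (yes _)  ()

corollary3p11 : (n : ℕ) (R : BRel n) → IsPartialOrderB R →
    (Qs : List (BRel n)) →
    All (λ Q → IsPartialOrderB Q × RotationEquivalent R Q) Qs →
    AllPairs Distinct Qs →
    length Qs ≤ 2 ^ n
corollary3p11 n R _ Qs equivalent distinct = list-pigeonhole (code ∘ minimals) collide equivalent distinct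
  where
  -- two orders with the same minimal elements are twists of each other
  -- (through R), hence equal
  collide : ∀ {Q Q'} → IsPartialOrderB Q × RotationEquivalent R Q → IsPartialOrderB Q' × RotationEquivalent R Q' →
            code (minimals Q) ≡ code (minimals Q') → ¬ Distinct Q Q'
  collide {Q} {Q'} (po , R~Q) (po' , R~Q') same-code differ = differ (Rigidity.twisted-orders-agree po po'
    (twist-trans (twist-sym (equivalent-twist R~Q)) (equivalent-twist R~Q'))
    (λ m → does-agree (isMinimal? Q m) (isMinimal? Q' m) (code-injective same-code m)))
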